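{- Let $x,y\in\mathrm{PVAR}$. For every memory state $(s,h)$, we have $(s,h)\models \mathbf{n}(x,y)$ if and only if $s(x),s(y)\in\mathrm{dom}(h)$ and $h(s(x))=h(s(y))$, where $\mathbf{n}(x,y)$ denotes the formula $$\Big(x\neq y\Rightarrow\Big[\mathrm{alloc}(x)\wedge\mathrm{alloc}(y)\wedge\Big((x\hookrightarrow y\wedge y\hookrightarrow y)\vee(y\hookrightarrow x\wedge x\hookrightarrow x)\vee\Big(\bigwedge_{z,z'\in\{x,y\}}\neg(z\hookrightarrow z')\wedge\big(\top-\!*\neg(\mathrm{reach}(x,y)=2\wedge\mathrm{reach}(y,x)=2)\big)\Big)\Big)\Big]_2\Big)\wedge\mathrm{alloc}(x).$$
   Context: A memory state is a pair $(s,h)$ with $s:\mathrm{PVAR}\to\mathrm{LOC}$ ($\mathrm{PVAR}$, $\mathrm{LOC}$ countably infinite) and $h$ a partial function $\mathrm{LOC}\to\mathrm{LOC}$ with finite domain $\mathrm{dom}(h)$. Disjoint heaps have union $h_1+h_2$. Semantics: $(s,h)\models x=y$ iff $s(x)=s(y)$; $\mathrm{emp}$ iff $\mathrm{dom}(h)=\emptyset$; $x\hookrightarrow y$ iff $s(x)\in\mathrm{dom}(h)$ and $h(s(x))=s(y)$; $\mathrm{ls}(x,y)$ iff either ($\mathrm{dom}(h)=\emptyset$ and $s(x)=s(y)$) or $h=\{l_0\mapsto l_1,\dots,l_{n-1}\mapsto l_n\}$ with $n\ge1$, $l_0=s(x)$, $l_n=s(y)$, $l_0,\dots,l_n$ pairwise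 distinct; $\varphi_1*\varphi_2$ iff $h=h_1+h_2$ for disjoint $h_1,h_2$ with $(s,h_1)\models\varphi_1$, $(s,h_2)\models\varphi_2$; $\varphi_1-\!*\varphi_2$ iff for every $h_1$ disjoint from $h$ with $(s,h_1)\models\varphi_1$, $(s,h+h_1)\models\varphi_2$; Boolean connectives as usual, $x\neq y:=\neg(x=y)$. Abbreviations: $\mathrm{size}\ge0:=\top$, $\mathrm{size}\ge\beta+1:=(\mathrm{size}\ge\beta)*\neg\mathrm{emp}$, $\mathrm{size}=\beta:=\neg(\mathrm{size}\ge\beta+1)\wedge\mathrm{size}\ge\beta$; $\mathrm{alloc}(x):=(x\hookrightarrow x)-\!*\bot$; $[\varphi]_\gamma:=(\mathrm{size}=\gamma\wedge\varphi)*\top$; $\mathrm{reach}(x,y)=\gamma:=[\mathrm{ls}(x,y)]_\gamma$. -}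

module Defs where

open import Data.Nat using (ℕ; zero; suc; _≤_; _⊔_)
open import Data.Nat.Properties using (m≤m⊔n; m≤n⊔m; ≤-trans)
open import Data.Maybe using (Maybe; just; nothing)
open import Data.Fin using (Fin; inject₁; fromℕ) renaming (zero to fzero; suc to fsuc)
open import Data.Product using (Σ; ∃; _×_; _,_)
open import Data.Sum using (_⊎_)
open import Data.Empty using (⊥)
open import Data.Unit using (⊤)
open import Relation.Nullary using (¬_)
open import Relation.Binary.PropositionalEquality using (_≡_; _≢_)
open import Function.Definitions using (Injective)

PVAR : Set
PVAR = ℕ

LOC : Set
LOC = ℕ

Store : Set
Store = PVAR → LOC

record Heap : Set where
  constructor mkHeap
  field
    fun    : LOC → Maybe LOC
    finite : Σ ℕ λ b → ∀ l → b ≤ l → fun l ≡ nothing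
open Heap public

_∈dom_ : LOC → Heap → Set
l ∈dom h = Σ LOC λ v → fun h l ≡ just v

Disjoint : Heap → Heap → Set
Disjoint h₁ h₂ = ∀ l → fun h₁ l ≡ nothing ⊎ fun h₂ l ≡ nothing

unionFun : (LOC → Maybe LOC) → (LOC → Maybe LOC) → LOC → Maybe LOC
unionFun f g l with f l
... | just v  = just v
... | nothing = g l

_∪_ : Heap → Heap → Heap
h₁ ∪ h₂ = mkHeap (unionFun (fun h₁) (fun h₂)) (b₁ ⊔ b₂ , fin)
  where
  b₁ = Σ.proj₁ (finite h₁)
  b₂ = Σ.proj₁ (finite h₂)
  fin : ∀ l → b₁ ⊔ b₂ ≤ l → unionFun (fun h₁) (fun h₂) l ≡ nothing
  fin l le with fun h₁ l | Σ.proj₂ (finite h₁) l (≤-trans (m≤m⊔n b₁ b₂) le)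
  ... | nothing | _ = Σ.proj₂ (finite h₂) l (≤-trans (m≤n⊔m b₁ b₂) le)

_≈ₕ_ : Heap → Heap → Set
h ≈ₕ h' = ∀ l → fun h l ≡ fun h' l

IsSplit : Heap → Heap → Heap → Set
IsSplit h h₁ h₂ = Disjoint h₁ h₂ × (h ≈ₕ (h₁ ∪ h₂))

data Form : Set where
  _≐_   : PVAR → PVAR → Form
  emp   : Form
  _↪_   : PVAR → PVAR → Form
  ls    : PVAR → PVAR → Form
  _∗_   : Form → Form → Form
  _-∗_  : Form → Form → Form
  ⊤f    : Form
  ⊥f    : Form
  ¬f_   : Form → Form
  _∧f_  : Form → Form → Form
  _∨f_  : Form → Form → Form
  _⇒f_  : Form → Form → Form

infix 9 ¬f_
infixr 7 _∧f_
infixr 6 _∨f_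
infixr 5 _⇒f_
infixr 8 _∗_
infixr 4 _-∗_
infix 10 _≐_ _↪_

-- ls semantics, non-empty case: h = {l₀↦l₁,…,l_{n-1}↦l_n}, n ≥ 1, l_i pairwise distinct.
LsNonEmpty : LOC → LOC → Heap → Set
LsNonEmpty a b h =
  Σ ℕ λ m → Σ (Fin (suc (suc m)) → LOC) λ l →
      Injective _≡_ _≡_ l
    × l fzero ≡ a
    × l (fromℕ (suc m)) ≡ b
    × (∀ (i : Fin (suc m)) → fun h (l (inject₁ i)) ≡ just (l (fsuc i)))
    × (∀ loc → (∀ (i : Fin (suc m)) → loc ≢ l (inject₁ i)) → fun h loc ≡ nothing)

IsEmp : Heap → Set
IsEmp h = ∀ l → fun h l ≡ nothing

_,_⊨_ : Store → Heap → Form → Set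
s , h ⊨ (x ≐ y) = s x ≡ s y
s , h ⊨ emp = IsEmp h
s , h ⊨ (x ↪ y) = fun h (s x) ≡ just (s y)
s , h ⊨ ls x y = (IsEmp h × s x ≡ s y) ⊎ LsNonEmpty (s x) (s y) h
s , h ⊨ (φ ∗ ψ) = Σ Heap λ h₁ → Σ Heap λ h₂ → IsSplit h h₁ h₂ × (s , h₁ ⊨ φ) × (s , h₂ ⊨ ψ)
s , h ⊨ (φ -∗ ψ) = ∀ (h₁ : Heap) → Disjoint h h₁ → s , h₁ ⊨ φ → s , (h ∪ h₁) ⊨ ψ
s , h ⊨ ⊤f = ⊤
s , h ⊨ ⊥f = ⊥
s , h ⊨ (¬f φ) = ¬ (s , h ⊨ φ)
s , h ⊨ (φ ∧f ψ) = (s , h ⊨ φ) × (s , h ⊨ ψ)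
s , h ⊨ (φ ∨f ψ) = (s , h ⊨ φ) ⊎ (s , h ⊨ ψ)
s , h ⊨ (φ ⇒f ψ) = (s , h ⊨ φ) → (s , h ⊨ ψ)

_≠_ : PVAR → PVAR → Form
x ≠ y = ¬f (x ≐ y)

size≥ : ℕ → Form
size≥ zero = ⊤f
size≥ (suc β) = size≥ β ∗ (¬f emp)

size≡ : ℕ → Form
size≡ β = (¬f (size≥ (suc β))) ∧f size≥ β

alloc : PVAR → Form
alloc x = (x ↪ x) -∗ ⊥f

[_]_ : Form → ℕ → Form
[ φ ] γ = (size≡ γ ∧f φ) ∗ ⊤f

reach≡ : PVAR → PVAR → ℕ → Form
reach≡ x y γ = [ ls x y ] γ

nForm : PVAR → PVAR → Form
nForm x y =
  ((x ≠ y) ⇒f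
     ([ alloc x ∧f (alloc y ∧f
          (((x ↪ y) ∧f (y ↪ y))
           ∨f (((y ↪ x) ∧f (x ↪ x))
           ∨f ((¬f (x ↪ x) ∧f (¬f (x ↪ y) ∧f (¬f (y ↪ x) ∧f ¬f (y ↪ y))))
               ∧f (⊤f -∗ (¬f (reach≡ x y 2 ∧f reach≡ y x 2))))))) ] 2))
  ∧f alloc x

-- If s x = s y the formula reduces to alloc(x). Otherwise it asks for a two-cell subheap T
-- allocating x and y in which either both point to y, or both point to x, or both point
-- outside {x, y}. In the last case the targets a, b are unallocated in T (T has only two
-- cells), so if a ≠ b, extending T by a ↦ y and b ↦ x produces the paths x → a → y and
-- y → b → x of length 2, which the guard ⊤ -∗ ¬(reach(x,y)=2 ∧ reach(y,x)=2) forbids.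
-- Conversely, if x and y share a target a ∉ {x, y}, length-2 paths from x to y and from
-- y to x must both continue from a, forcing x = y.
module Submission where

open import Defs
open import Data.Product using (_×_)
open import Relation.Binary.PropositionalEquality using (_≡_)
open import Function.Bundles using (_⇔_)

open import Data.Nat using (ℕ; zero; suc; _≤_; _≟_)
open import Data.Nat.Properties using (<⇒≢)
open import Data.Maybe using (Maybe; just; nothing)
open import Data.Maybe.Properties using (just-injective)
open import Data.Fin using (Fin; inject₁) renaming (zero to fzero; suc to fsuc)
open import Data.Product using (Σ; _,_; proj₁; proj₂)
open import Data.Sum using (_⊎_; inj₁; inj₂)
open import Data.Empty using (⊥; ⊥-elim)
open import Data.Unit using (tt)
open import Relation.Nullary using (¬_; yes; no)
open import Relation.Binary.PropositionalEquality
  using (_≢_; refl; sym; trans; cong; subst; subst₂; ≢-sym)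
open import Function.Bundles using (mk⇔)
open import Function.Base using (case_of_)
open import Function.Definitions using (Injective)

just≢nothing : ∀ {v : LOC} → just v ≢ nothing
just≢nothing ()

target≢ : ∀ {H l a b} → fun H l ≡ just a → fun H l ≢ just b → a ≢ b
target≢ Hl≡a Hl≢b a≡b = Hl≢b (trans Hl≡a (cong just a≡b))

¬target : ∀ {H l a b} → fun H l ≡ just a → a ≢ b → fun H l ≢ just b
¬target Hl≡a a≢b Hl≡b = a≢b (just-injective (trans (sym Hl≡a) Hl≡b))

lookup-view : ∀ H l → l ∈dom H ⊎ fun H l ≡ nothing
lookup-view H l with fun H l
... | just v  = inj₁ (v , refl)
... | nothing = inj₂ refl

_⊆_ : Heap → Heap → Set
A ⊆ H = ∀ {l v} → fun A l ≡ just v → fun H l ≡ just v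

⊆-trans : ∀ {A B C} → A ⊆ B → B ⊆ C → A ⊆ C
⊆-trans A⊆B B⊆C Al = B⊆C (A⊆B Al)

⊆-nothing : ∀ {A H l} → A ⊆ H → fun H l ≡ nothing → fun A l ≡ nothing
⊆-nothing {A} {l = l} A⊆H Hl≡nothing with fun A l in Al
... | nothing = refl
... | just v  = ⊥-elim (just≢nothing (trans (sym (A⊆H Al)) Hl≡nothing))

⊆-disjointˡ : ∀ {A H B} → A ⊆ H → Disjoint H B → Disjoint A B
⊆-disjointˡ {A} {H} A⊆H H#B l with H#B l
... | inj₁ Hl≡nothing = inj₁ (⊆-nothing {A} {H} A⊆H Hl≡nothing)
... | inj₂ Bl≡nothing = inj₂ Bl≡nothing

disjoint-clash : ∀ {A B l} → Disjoint A B → l ∈dom A → l ∈dom B → ⊥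
disjoint-clash {l = l} A#B (v , Al) (w , Bl) with A#B l
... | inj₁ Al≡nothing = just≢nothing (trans (sym Al) Al≡nothing)
... | inj₂ Bl≡nothing = just≢nothing (trans (sym Bl) Bl≡nothing)

∪-lookupˡ : ∀ A B {l v} → fun A l ≡ just v → fun (A ∪ B) l ≡ just v
∪-lookupˡ A B {l} Al with fun A l
... | just _ = Al

∪-lookupʳ : ∀ A B {l} → fun A l ≡ nothing → fun (A ∪ B) l ≡ fun B l
∪-lookupʳ A B {l} Al with fun A l
... | nothing = refl

∪-⊆ : ∀ {A B H} → A ⊆ H → B ⊆ H → (A ∪ B) ⊆ H
∪-⊆ {A} {B} A⊆H B⊆H {l} ABl with lookup-view A l
... | inj₁ (_ , Al)   = A⊆H (trans Al (trans (sym (∪-lookupˡ A B Al)) ABl))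
... | inj₂ Al≡nothing = B⊆H (trans (sym (∪-lookupʳ A B Al≡nothing)) ABl)

disjoint-∪ : ∀ {H A B} → Disjoint H A → Disjoint H B → Disjoint H (A ∪ B)
disjoint-∪ {A = A} {B} H#A H#B l with H#A l | H#B l
... | inj₁ Hl≡nothing | _ = inj₁ Hl≡nothing
... | inj₂ _ | inj₁ Hl≡nothing = inj₁ Hl≡nothing
... | inj₂ Al≡nothing | inj₂ Bl≡nothing = inj₂ (trans (∪-lookupʳ A B Al≡nothing) Bl≡nothing)

∪-comm-at : ∀ A B {l} → fun A l ≡ nothing → fun (A ∪ B) l ≡ fun (B ∪ A) l
∪-comm-at A B {l} Al≡nothing with lookup-view B l
... | inj₁ (_ , Bl) = trans (∪-lookupʳ A B Al≡nothing) (trans Bl (sym (∪-lookupˡ B A Bl)))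
... | inj₂ Bl≡nothing =
  trans (∪-lookupʳ A B Al≡nothing)
    (trans Bl≡nothing (trans (sym Al≡nothing) (sym (∪-lookupʳ B A Bl≡nothing))))

split-comm : ∀ {H A B} → IsSplit H A B → IsSplit H B A
split-comm {A = A} {B} (A#B , H≈A∪B) = B#A , λ l → trans (H≈A∪B l) (swap l)
  where
  B#A : Disjoint B A
  B#A l with A#B l
  ... | inj₁ Al≡nothing = inj₂ Al≡nothing
  ... | inj₂ Bl≡nothing = inj₁ Bl≡nothing
  swap : ∀ l → fun (A ∪ B) l ≡ fun (B ∪ A) l
  swap l with A#B l
  ... | inj₁ Al≡nothing = ∪-comm-at A B Al≡nothing
  ... | inj₂ Bl≡nothing = sym (∪-comm-at B A Bl≡nothing)

split-⊆ˡ : ∀ {H A B} → IsSplit H A B → A ⊆ H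
split-⊆ˡ {A = A} {B} (_ , H≈A∪B) {l} Al = trans (H≈A∪B l) (∪-lookupˡ A B Al)

split-⊆ʳ : ∀ {H A B} → IsSplit H A B → B ⊆ H
split-⊆ʳ {H} {A} {B} split = split-⊆ˡ {H} {B} {A} (split-comm {H} {A} {B} split)

singletonFun : LOC → LOC → LOC → Maybe LOC
singletonFun p u l with l ≟ p
... | yes _ = just u
... | no _  = nothing

↦-off : ∀ {p u l} → l ≢ p → singletonFun p u l ≡ nothing
↦-off {p} {l = l} l≢p with l ≟ p
... | yes l≡p = ⊥-elim (l≢p l≡p)
... | no _    = refl

_↦_ : LOC → LOC → Heap
p ↦ u = mkHeap (singletonFun p u) (suc p , λ l p<l → ↦-off (≢-sym (<⇒≢ p<l)))

↦-at : ∀ p u → fun (p ↦ u) p ≡ just u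
↦-at p u with p ≟ p
... | yes _   = refl
... | no p≢p = ⊥-elim (p≢p refl)

↦-⊆ : ∀ {H p u} → fun H p ≡ just u → (p ↦ u) ⊆ H
↦-⊆ {p = p} Hp {l} pl with l ≟ p
↦-⊆ Hp refl | yes refl = Hp

↦-disjoint : ∀ {H p u} → fun H p ≡ nothing → Disjoint H (p ↦ u)
↦-disjoint {p = p} {u} Hp≡nothing l = case l ≟ p of λ where
  (yes refl) → inj₁ Hp≡nothing
  (no l≢p)   → inj₂ (↦-off {p} {u} l≢p)

pair : LOC → LOC → LOC → LOC → Heap
pair p u q w = (p ↦ u) ∪ (q ↦ w)

pair-at₁ : ∀ p u q w → fun (pair p u q w) p ≡ just u
pair-at₁ p u q w = ∪-lookupˡ (p ↦ u) (q ↦ w) (↦-at p u)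

pair-at₂ : ∀ {p} u {q} w → q ≢ p → fun (pair p u q w) q ≡ just w
pair-at₂ {p} u {q} w q≢p = trans (∪-lookupʳ (p ↦ u) (q ↦ w) (↦-off q≢p)) (↦-at q w)

pair-off : ∀ {p u q w l} → l ≢ p → l ≢ q → fun (pair p u q w) l ≡ nothing
pair-off {p} {u} {q} {w} l≢p l≢q = trans (∪-lookupʳ (p ↦ u) (q ↦ w) (↦-off l≢p)) (↦-off l≢q)

pair-⊆ : ∀ {H p u q w} → fun H p ≡ just u → fun H q ≡ just w → pair p u q w ⊆ H
pair-⊆ {H} {p} {u} {q} {w} Hp Hq = ∪-⊆ {p ↦ u} {q ↦ w} {H} (↦-⊆ {H} Hp) (↦-⊆ {H} Hq)

pair-disjoint : ∀ {H p u q w} →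
  fun H p ≡ nothing → fun H q ≡ nothing → Disjoint H (pair p u q w)
pair-disjoint {H} {p} {u} {q} {w} Hp Hq =
  disjoint-∪ {H} {p ↦ u} {q ↦ w} (↦-disjoint {H} {p} {u} Hp) (↦-disjoint {H} {q} {w} Hq)

_∖_ : Heap → Heap → Heap
H ∖ T = mkHeap lookup (bound , lookup-beyond)
  where
  lookup : LOC → Maybe LOC
  lookup l with fun T l
  ... | just _  = nothing
  ... | nothing = fun H l
  bound : ℕ
  bound = proj₁ (finite H)
  lookup-beyond : ∀ l → bound ≤ l → lookup l ≡ nothing
  lookup-beyond l bound≤l with fun T l
  ... | just _  = refl
  ... | nothing = proj₂ (finite H) l bound≤l

∖-lookup-in : ∀ H T {l v} → fun T l ≡ just v → fun (H ∖ T) l ≡ nothing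
∖-lookup-in H T {l} Tl with fun T l
... | just _ = refl

∖-lookup-out : ∀ H T {l} → fun T l ≡ nothing → fun (H ∖ T) l ≡ fun H l
∖-lookup-out H T {l} Tl with fun T l
... | nothing = refl

∖-split : ∀ {H T} → T ⊆ H → IsSplit H T (H ∖ T)
∖-split {H} {T} T⊆H = T#H∖T , H≈T∪H∖T
  where
  T#H∖T : Disjoint T (H ∖ T)
  T#H∖T l with lookup-view T l
  ... | inj₁ (_ , Tl)   = inj₂ (∖-lookup-in H T Tl)
  ... | inj₂ Tl≡nothing = inj₁ Tl≡nothing
  H≈T∪H∖T : H ≈ₕ (T ∪ (H ∖ T))
  H≈T∪H∖T l with lookup-view T l
  ... | inj₁ (_ , Tl)   = trans (T⊆H Tl) (sym (∪-lookupˡ T (H ∖ T) Tl))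
  ... | inj₂ Tl≡nothing =
    sym (trans (∪-lookupʳ T (H ∖ T) Tl≡nothing) (∖-lookup-out H T Tl≡nothing))

∖↦-keeps : ∀ {H p u l v} → l ≢ p → fun H l ≡ just v → fun (H ∖ (p ↦ u)) l ≡ just v
∖↦-keeps {H} {p} {u} l≢p Hl = trans (∖-lookup-out H (p ↦ u) (↦-off l≢p)) Hl

size≥-suc : ∀ {s H l v} n →
  fun H l ≡ just v → s , H ∖ (l ↦ v) ⊨ size≥ n → s , H ⊨ size≥ (suc n)
size≥-suc {H = H} {l} {v} n Hl size≥n =
  H ∖ (l ↦ v) , l ↦ v ,
  split-comm {H} {l ↦ v} {H ∖ (l ↦ v)} (∖-split {H} {l ↦ v} (↦-⊆ {H} {l} {v} Hl)) , size≥n ,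
  λ empty → just≢nothing (trans (sym (↦-at l v)) (empty l))

two-allocated : ∀ {s H p q} → p ≢ q → p ∈dom H → q ∈dom H → s , H ⊨ size≥ 2
two-allocated {s} {H} {p} {q} p≢q (u , Hp) (w , Hq) =
  size≥-suc {s} {H} 1 Hp
    (size≥-suc {s} {H ∖ (p ↦ u)} {q} {w} 0 (∖↦-keeps {H} {p} {u} (≢-sym p≢q) Hq) tt)

three-allocated : ∀ {s H p q r} → p ≢ q → p ≢ r → q ≢ r →
  p ∈dom H → q ∈dom H → r ∈dom H → s , H ⊨ size≥ 3
three-allocated {s} {H} {p} {q} {r} p≢q p≢r q≢r (u , Hp) (w , Hq) (t , Hr) =
  size≥-suc {s} {H} 2 Hp
    (size≥-suc {s} {H₁} {q} {w} 1 (∖↦-keeps {H} {p} {u} (≢-sym p≢q) Hq)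
      (size≥-suc {s} {H₁ ∖ (q ↦ w)} {r} {t} 0
        (∖↦-keeps {H₁} {q} {w} (≢-sym q≢r) (∖↦-keeps {H} {p} {u} (≢-sym p≢r) Hr)) tt))
  where
  H₁ : Heap
  H₁ = H ∖ (p ↦ u)

DomWithin : Heap → LOC → LOC → Set
DomWithin H p q = ∀ l → l ≢ p → l ≢ q → fun H l ≡ nothing

⊆-within : ∀ {A H p q} → A ⊆ H → DomWithin H p q → DomWithin A p q
⊆-within {A} {H} A⊆H within l l≢p l≢q = ⊆-nothing {A} {H} A⊆H (within l l≢p l≢q)

nonempty-within : ∀ {H p q} → DomWithin H p q → ¬ IsEmp H → p ∈dom H ⊎ q ∈dom H
nonempty-within {H} {p} {q} within nonempty with lookup-view H p | lookup-view H q
... | inj₁ p∈H | _        = inj₁ p∈H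
... | inj₂ _   | inj₁ q∈H = inj₂ q∈H
... | inj₂ Hp≡nothing | inj₂ Hq≡nothing = ⊥-elim (nonempty empty)
  where
  empty : IsEmp H
  empty l with l ≟ p | l ≟ q
  ... | yes refl | _        = Hp≡nothing
  ... | no _     | yes refl = Hq≡nothing
  ... | no l≢p   | no l≢q   = within l l≢p l≢q

within⇒¬size≥3 : ∀ {s H p q} → DomWithin H p q → ¬ (s , H ⊨ size≥ 3)
within⇒¬size≥3 {H = H} {p} {q} within
  ( H₁ , C , split₁@(H₁#C , _)
  , (H₂ , B , split₂@(H₂#B , _) , (H₃ , A , split₃ , _ , A≠∅) , B≠∅)
  , C≠∅) =
  -- size ≥ 3 yields three pairwise disjoint nonempty subheaps, each of which owns p or q.
  pigeonhole (owner {A} A⊆H A≠∅) (owner {B} B⊆H B≠∅) (owner {C} C⊆H C≠∅)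
  where
  H₁⊆H : H₁ ⊆ H
  H₁⊆H = split-⊆ˡ {H} {H₁} {C} split₁
  A⊆H₂ : A ⊆ H₂
  A⊆H₂ = split-⊆ʳ {H₂} {H₃} {A} split₃
  A⊆H₁ : A ⊆ H₁
  A⊆H₁ = ⊆-trans {A} {H₂} {H₁} A⊆H₂ (split-⊆ˡ {H₁} {H₂} {B} split₂)
  B⊆H₁ : B ⊆ H₁
  B⊆H₁ = split-⊆ʳ {H₁} {H₂} {B} split₂
  A⊆H : A ⊆ H
  A⊆H = ⊆-trans {A} {H₁} {H} A⊆H₁ H₁⊆H
  B⊆H : B ⊆ H
  B⊆H = ⊆-trans {B} {H₁} {H} B⊆H₁ H₁⊆H
  C⊆H : C ⊆ H
  C⊆H = split-⊆ʳ {H} {H₁} {C} split₁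
  owner : ∀ {G} → G ⊆ H → ¬ IsEmp G → p ∈dom G ⊎ q ∈dom G
  owner {G} G⊆H = nonempty-within {G} (⊆-within {G} {H} G⊆H within)
  A#B : Disjoint A B
  A#B = ⊆-disjointˡ {A} {H₂} {B} A⊆H₂ H₂#B
  A#C : Disjoint A C
  A#C = ⊆-disjointˡ {A} {H₁} {C} A⊆H₁ H₁#C
  B#C : Disjoint B C
  B#C = ⊆-disjointˡ {B} {H₁} {C} B⊆H₁ H₁#C
  pigeonhole : p ∈dom A ⊎ q ∈dom A → p ∈dom B ⊎ q ∈dom B → p ∈dom C ⊎ q ∈dom C → ⊥
  pigeonhole (inj₁ a) (inj₁ b) _        = disjoint-clash {A} {B} A#B a b
  pigeonhole (inj₁ a) (inj₂ _) (inj₁ c) = disjoint-clash {A} {C} A#C a c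
  pigeonhole (inj₁ _) (inj₂ b) (inj₂ c) = disjoint-clash {B} {C} B#C b c
  pigeonhole (inj₂ _) (inj₁ b) (inj₁ c) = disjoint-clash {B} {C} B#C b c
  pigeonhole (inj₂ a) (inj₁ _) (inj₂ c) = disjoint-clash {A} {C} A#C a c
  pigeonhole (inj₂ a) (inj₂ b) _        = disjoint-clash {A} {B} A#B a b

¬size≥3⇒within : ∀ {s H p q} → ¬ (s , H ⊨ size≥ 3) →
  p ≢ q → p ∈dom H → q ∈dom H → DomWithin H p q
¬size≥3⇒within {s} {H} ¬size≥3 p≢q p∈H q∈H l l≢p l≢q with lookup-view H l
... | inj₁ l∈H        =
  ⊥-elim (¬size≥3 (three-allocated {s} {H} p≢q (≢-sym l≢p) (≢-sym l≢q) p∈H q∈H l∈H))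
... | inj₂ Hl≡nothing = Hl≡nothing

pair-size≡2 : ∀ {s p q} u w → p ≢ q → s , pair p u q w ⊨ size≡ 2
pair-size≡2 {s} {p} {q} u w p≢q =
  within⇒¬size≥3 {s} {pair p u q w} (λ l l≢p l≢q → pair-off {p} {u} {q} {w} l≢p l≢q) ,
  two-allocated {s} {pair p u q w} p≢q (u , pair-at₁ p u q w) (w , pair-at₂ u w (≢-sym p≢q))

alloc⇒∈dom : ∀ {s H x} → s , H ⊨ alloc x → s x ∈dom H
alloc⇒∈dom {s} {H} {x} alloc-x with lookup-view H (s x)
... | inj₁ x∈H        = x∈H
... | inj₂ Hx≡nothing =
  ⊥-elim (alloc-x (s x ↦ s x) (↦-disjoint {H} Hx≡nothing) (↦-at (s x) (s x)))

∈dom⇒alloc : ∀ {s H x} → s x ∈dom H → s , H ⊨ alloc x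
∈dom⇒alloc {H = H} x∈H G H#G Gx = disjoint-clash {H} {G} H#G x∈H (_ , Gx)

Path≤2 : Heap → LOC → LOC → Set
Path≤2 H p q = fun H p ≡ just q ⊎ Σ LOC λ c → fun H p ≡ just c × fun H c ≡ just q

⊆-path : ∀ {A H p q} → A ⊆ H → Path≤2 A p q → Path≤2 H p q
⊆-path A⊆H (inj₁ Ap≡q)              = inj₁ (A⊆H Ap≡q)
⊆-path A⊆H (inj₂ (c , Ap≡c , Ac≡q)) = inj₂ (c , A⊆H Ap≡c , A⊆H Ac≡q)

ls⇒path : ∀ {s H x y} → s x ≢ s y → ¬ (s , H ⊨ size≥ 3) →
  s , H ⊨ ls x y → Path≤2 H (s x) (s y)
ls⇒path x≢y _ (inj₁ (_ , x≡y)) = ⊥-elim (x≢y x≡y)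
ls⇒path {H = H} _ _ (inj₂ (zero , l , _ , l₀≡x , l₁≡y , edge , _)) =
  inj₁ (subst₂ (λ p q → fun H p ≡ just q) l₀≡x l₁≡y (edge fzero))
ls⇒path {H = H} _ _ (inj₂ (suc zero , l , _ , l₀≡x , l₂≡y , edge , _)) =
  inj₂ (l (fsuc fzero) ,
        subst (λ p → fun H p ≡ just (l (fsuc fzero))) l₀≡x (edge fzero) ,
        subst (λ q → fun H (l (fsuc fzero)) ≡ just q) l₂≡y (edge (fsuc fzero)))
ls⇒path {s} {H} _ ¬size≥3 (inj₂ (suc (suc _) , l , l-inj , _ , _ , edge , _)) =
  ⊥-elim (¬size≥3 (three-allocated {s} {H}
    (λ e → case l-inj e of λ ()) (λ e → case l-inj e of λ ()) (λ e → case l-inj e of λ ())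
    (_ , edge fzero) (_ , edge (fsuc fzero)) (_ , edge (fsuc (fsuc fzero)))))

reach≡2⇒path : ∀ {s H x y} → s x ≢ s y → s , H ⊨ reach≡ x y 2 → Path≤2 H (s x) (s y)
reach≡2⇒path {s} {H} x≢y (T , R , split , ((¬size≥3 , _) , ls-xy) , _) =
  ⊆-path {T} {H} (split-⊆ˡ {H} {T} {R} split) (ls⇒path {s} {T} x≢y ¬size≥3 ls-xy)

path⇒reach≡2 : ∀ {s H x y c} → s x ≢ c → c ≢ s y → s x ≢ s y →
  fun H (s x) ≡ just c → fun H c ≡ just (s y) → s , H ⊨ reach≡ x y 2
path⇒reach≡2 {s} {H} {x} {y} {c} x≢c c≢y x≢y Hx Hc =
  T , H ∖ T , ∖-split {H} {T} (pair-⊆ {H} Hx Hc) ,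
  (pair-size≡2 {s} c (s y) x≢c , inj₂ (1 , l , l-inj , refl , refl , edge , off)) , tt
  where
  T : Heap
  T = pair (s x) c c (s y)
  l : Fin 3 → LOC
  l fzero                = s x
  l (fsuc fzero)         = c
  l (fsuc (fsuc fzero))  = s y
  l-inj : Injective _≡_ _≡_ l
  l-inj {fzero}               {fzero}               _ = refl
  l-inj {fzero}               {fsuc fzero}          e = ⊥-elim (x≢c e)
  l-inj {fzero}               {fsuc (fsuc fzero)}   e = ⊥-elim (x≢y e)
  l-inj {fsuc fzero}          {fzero}               e = ⊥-elim (x≢c (sym e))
  l-inj {fsuc fzero}          {fsuc fzero}          _ = refl
  l-inj {fsuc fzero}          {fsuc (fsuc fzero)}   e = ⊥-elim (c≢y e)
  l-inj {fsuc (fsuc fzero)}   {fzero}               e = ⊥-elim (x≢y (sym e))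
  l-inj {fsuc (fsuc fzero)}   {fsuc fzero}          e = ⊥-elim (c≢y (sym e))
  l-inj {fsuc (fsuc fzero)}   {fsuc (fsuc fzero)}   _ = refl
  edge : ∀ i → fun T (l (inject₁ i)) ≡ just (l (fsuc i))
  edge fzero        = pair-at₁ (s x) c c (s y)
  edge (fsuc fzero) = pair-at₂ c (s y) (≢-sym x≢c)
  off : ∀ loc → (∀ i → loc ≢ l (inject₁ i)) → fun T loc ≡ nothing
  off loc loc∉l = pair-off {s x} {c} {c} {s y} (loc∉l fzero) (loc∉l (fsuc fzero))

noEdges : PVAR → PVAR → Form
noEdges x y = ¬f (x ↪ x) ∧f (¬f (x ↪ y) ∧f (¬f (y ↪ x) ∧f ¬f (y ↪ y)))

twoCycleFree : PVAR → PVAR → Form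
twoCycleFree x y = ⊤f -∗ (¬f (reach≡ x y 2 ∧f reach≡ y x 2))

targetCases : PVAR → PVAR → Form
targetCases x y =
  ((x ↪ y) ∧f (y ↪ y)) ∨f (((y ↪ x) ∧f (x ↪ x)) ∨f (noEdges x y ∧f twoCycleFree x y))

nBody : PVAR → PVAR → Form
nBody x y = alloc x ∧f (alloc y ∧f targetCases x y)

shared-target⇒¬2-cycle : ∀ {s H x y a} → s x ≢ s y → a ≢ s x → a ≢ s y →
  fun H (s x) ≡ just a → fun H (s y) ≡ just a → ¬ (s , H ⊨ (reach≡ x y 2 ∧f reach≡ y x 2))
shared-target⇒¬2-cycle {s} {H} {x} {y} x≢y a≢x a≢y Hx Hy (reach-xy , reach-yx)
  with reach≡2⇒path {s} {H} {x} {y} x≢y reach-xy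
     | reach≡2⇒path {s} {H} {y} {x} (≢-sym x≢y) reach-yx
... | inj₁ Hx≡y | _         = ¬target {H} Hx a≢y Hx≡y
... | inj₂ _    | inj₁ Hy≡x = ¬target {H} Hy a≢x Hy≡x
... | inj₂ (_ , Hx≡c , Hc≡y) | inj₂ (_ , Hy≡c′ , Hc′≡x)
  with just-injective (trans (sym Hx) Hx≡c) | just-injective (trans (sym Hy) Hy≡c′)
...   | refl | refl = x≢y (just-injective (trans (sym Hc′≡x) Hc≡y))

shared-target-cases : ∀ {s H x y a} → s x ≢ s y →
  fun H (s x) ≡ just a → fun H (s y) ≡ just a → s , H ⊨ targetCases x y
shared-target-cases {s} {H} {x} {y} {a} x≢y Hx Hy with a ≟ s y | a ≟ s x
... | yes refl | _        = inj₁ (Hx , Hy)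
... | no _     | yes refl = inj₂ (inj₁ (Hy , Hx))
... | no a≢y   | no a≢x   =
  inj₂ (inj₂ (
    (¬target {H} Hx a≢x , ¬target {H} Hx a≢y , ¬target {H} Hy a≢x , ¬target {H} Hy a≢y) ,
    λ G _ _ → shared-target⇒¬2-cycle {s} {H ∪ G} x≢y a≢x a≢y
                (∪-lookupˡ H G Hx) (∪-lookupˡ H G Hy)))

distinct-free-targets⇒2-cycle : ∀ {s T x y a b} → s x ≢ s y → a ≢ b →
  a ≢ s x → a ≢ s y → b ≢ s x → b ≢ s y → DomWithin T (s x) (s y) →
  fun T (s x) ≡ just a → fun T (s y) ≡ just b → ¬ (s , T ⊨ twoCycleFree x y)
distinct-free-targets⇒2-cycle {s} {T} {x} {y} {a} {b}
  x≢y a≢b a≢x a≢y b≢x b≢y within Tx Ty twoCycleFree-xy =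
  twoCycleFree-xy E (pair-disjoint {T} Ta≡nothing Tb≡nothing) tt
    ( path⇒reach≡2 {s} {T ∪ E} (≢-sym a≢x) a≢y x≢y (∪-lookupˡ T E Tx) T∪E-a
    , path⇒reach≡2 {s} {T ∪ E} (≢-sym b≢y) b≢x (≢-sym x≢y) (∪-lookupˡ T E Ty) T∪E-b)
  where
  E : Heap
  E = pair a (s y) b (s x)
  Ta≡nothing : fun T a ≡ nothing
  Ta≡nothing = within a a≢x a≢y
  Tb≡nothing : fun T b ≡ nothing
  Tb≡nothing = within b b≢x b≢y
  T∪E-a : fun (T ∪ E) a ≡ just (s y)
  T∪E-a = trans (∪-lookupʳ T E Ta≡nothing) (pair-at₁ a (s y) b (s x))
  T∪E-b : fun (T ∪ E) b ≡ just (s x)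
  T∪E-b = trans (∪-lookupʳ T E Tb≡nothing) (pair-at₂ (s y) (s x) (≢-sym a≢b))

nBody⇒same-target : ∀ {s T x y} → s x ≢ s y → s , T ⊨ (size≡ 2 ∧f nBody x y) →
  Σ LOC λ a → fun T (s x) ≡ just a × fun T (s y) ≡ just a
nBody⇒same-target {s} {T} {x} {y} x≢y ((¬size≥3 , _) , alloc-x , alloc-y , cases)
  with alloc⇒∈dom {s} {T} {x} alloc-x | alloc⇒∈dom {s} {T} {y} alloc-y
... | a , Tx | b , Ty = a , Tx , trans Ty (cong just (sym (targets-agree cases)))
  where
  targets-agree : s , T ⊨ targetCases x y → a ≡ b
  targets-agree (inj₁ (Tx≡y , Ty≡y)) =
    trans (just-injective (trans (sym Tx) Tx≡y)) (just-injective (trans (sym Ty≡y) Ty))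
  targets-agree (inj₂ (inj₁ (Ty≡x , Tx≡x))) =
    trans (just-injective (trans (sym Tx) Tx≡x)) (just-injective (trans (sym Ty≡x) Ty))
  targets-agree (inj₂ (inj₂ ((¬x↪x , ¬x↪y , ¬y↪x , ¬y↪y) , twoCycleFree-xy))) with a ≟ b
  ... | yes a≡b = a≡b
  ... | no a≢b  = ⊥-elim (distinct-free-targets⇒2-cycle {s} {T} x≢y a≢b
          (target≢ {T} Tx ¬x↪x) (target≢ {T} Tx ¬x↪y)
          (target≢ {T} Ty ¬y↪x) (target≢ {T} Ty ¬y↪y)
          (¬size≥3⇒within {s} {T} ¬size≥3 x≢y (a , Tx) (b , Ty)) Tx Ty twoCycleFree-xy)

pair-nBody : ∀ {s x y} a → s x ≢ s y → s , pair (s x) a (s y) a ⊨ (size≡ 2 ∧f nBody x y)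
pair-nBody {s} {x} {y} a x≢y =
  pair-size≡2 {s} a a x≢y ,
  ∈dom⇒alloc {s} {T} {x} (a , Tx) , ∈dom⇒alloc {s} {T} {y} (a , Ty) ,
  shared-target-cases {s} {T} x≢y Tx Ty
  where
  T : Heap
  T = pair (s x) a (s y) a
  Tx : fun T (s x) ≡ just a
  Tx = pair-at₁ (s x) a (s y) a
  Ty : fun T (s y) ≡ just a
  Ty = pair-at₂ a a (≢-sym x≢y)

SameTarget : Heap → LOC → LOC → Set
SameTarget H p q = p ∈dom H × q ∈dom H × fun H p ≡ fun H q

same-target : ∀ {H p q a} → fun H p ≡ just a → fun H q ≡ just a → SameTarget H p q
same-target Hp Hq = (_ , Hp) , (_ , Hq) , trans Hp (sym Hq)

lemma3p10 : (x y : PVAR) (s : Store) (h : Heap) →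
    (s , h ⊨ nForm x y) ⇔ ((s x ∈dom h) × (s y ∈dom h) × (fun h (s x) ≡ fun h (s y)))
lemma3p10 x y s h = mk⇔ to from
  where
  to : s , h ⊨ nForm x y → SameTarget h (s x) (s y)
  to (bracket , alloc-x) with s x ≟ s y | alloc⇒∈dom {s} {h} {x} alloc-x
  ... | yes x≡y | x∈h = subst (SameTarget h (s x)) x≡y (x∈h , x∈h , refl)
  ... | no x≢y  | _ with bracket x≢y
  ...   | T , R , split , body , _ with nBody⇒same-target {s} {T} x≢y body
  ...     | _ , Tx , Ty = same-target {h} (T⊆h Tx) (T⊆h Ty)
    where
    T⊆h : T ⊆ h
    T⊆h = split-⊆ˡ {h} {T} {R} split
  from : SameTarget h (s x) (s y) → s , h ⊨ nForm x y
  from ((a , hx) , _ , hx≡hy) = bracket , ∈dom⇒alloc {s} {h} {x} (a , hx)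
    where
    bracket : s , h ⊨ (x ≠ y) → s , h ⊨ ([ nBody x y ] 2)
    bracket x≢y =
      pair (s x) a (s y) a , h ∖ pair (s x) a (s y) a ,
      ∖-split {h} {pair (s x) a (s y) a} (pair-⊆ {h} hx (trans (sym hx≡hy) hx)) ,
      pair-nBody {s} a x≢y , tt
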